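{- Let $n\ge3$, $k\ge0$, let $S$ be an independent set in $G_n^k$ and let $i\in[n+k]$. Then (1) $\mathrm{DFEL}(i,S)$ is independent in $G_n^k$; (2) $\mathrm{DLEF}(i,S)$ is independent in $G_n^k$; (3) $|\mathrm{DFEL}(i,S)|+|\mathrm{DLEF}(i,S)|=2|S|$.
   Context: The crown $S_n^k$ is the height-2 poset on $A\cup B$, $A=\{a_1,\dots,a_{n+k}\}$ minimal, $B=\{b_1,\dots,b_{n+k}\}$ maximal, indices cyclic mod $n+k$; $a_i$ is incomparable to $b_j$ iff $j\in\{i,\dots,i+k\}$ (mod $n+k$), otherwise $a_i<b_j$. $\mathrm{Inc}(A,B)$: incomparable pairs $(a,b)\in A\times B$; $G_n^k$: graph on $\mathrm{Inc}(A,B)$ with $(a,b)\sim(x,y)$ iff $a<y$ and $x<b$. For an independent set $S$ and $i\in[n+k]$, an ordered pair $((a,b),(x,y))$ of elements of $S$ is an expansion blocking pair at $i$ if $a=a_i$, $y=b_{i+k}$ and $x<b$ in $S_n^k$. $\mathrm{FEBP}(i,S)$ is the set of $(a,b)\in S$ which are the first entry of some expansion blocking pair at $i$ in $S$, and $\mathrm{LEBP}(i,S)$ the set of $(x,y)\in S$ which are the second entry of some expansion blocking pair at $i$ in $S$. Define $\mathrm{DFEL}(i,S)=(S-\mathrm{FEBP}(i,S))\cup\{(x,b_{i+k+1}):(x,b_{i+k})\in\mathrm{LEBP}(i,S)\}$ and $\mathrm{DLEF}(i,S)=(S-\mathrm{LEBP}(i,S))\cup\{(a_{i-1},b):(a_i,b)\in\mathrm{FEBP}(i,S)\}$.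 -}

module Defs where

open import Data.Nat using (ℕ; zero; suc; _+_; _∸_; _%_; _≤ᵇ_; _<ᵇ_)
open import Data.Nat.DivMod using (m%n<n)
open import Data.Fin using (Fin; toℕ; fromℕ<; _≟_)
open import Data.Bool using (Bool; true; false; _∧_; _∨_; not; if_then_else_)
open import Data.List using (List; allFin; map)
open import Data.Nat.ListAction using (sum)
open import Data.Bool.ListAction using (any)
open import Relation.Nullary.Decidable using (⌊_⌋)
open import Relation.Binary.PropositionalEquality using (_≡_)
open import Data.Product using (_×_)

-- Indices are 0,…,N-1 with N = n + k (the paper's 1,…,n+k shifted by one;
-- everything is cyclic so this relabelling is harmless).

cyc : ∀ {N} → Fin N → ℕ → Fin N
cyc {suc m} i d = fromℕ< (m%n<n (toℕ i + d) (suc m))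

cdist : ∀ {N} → Fin N → Fin N → ℕ
cdist {suc m} i j = (toℕ j + (suc m ∸ toℕ i)) % suc m

-- In the crown S_n^k (N = n + k): a_i is incomparable to b_j iff j ∈ {i,…,i+k} mod N
incomp : (n k : ℕ) → Fin (n + k) → Fin (n + k) → Bool
incomp n k i j = cdist i j ≤ᵇ k

lt : (n k : ℕ) → Fin (n + k) → Fin (n + k) → Bool
lt n k i j = not (incomp n k i j)

-- A subset of A × B, given by its characteristic function:
-- S x y = true means (a_x , b_y) ∈ S.
PairSet : ℕ → Set
PairSet N = Fin N → Fin N → Bool

adj : (n k : ℕ) → Fin (n + k) → Fin (n + k) → Fin (n + k) → Fin (n + k) → Bool
adj n k a b x y = lt n k a y ∧ lt n k x b

Independent : (n k : ℕ) → PairSet (n + k) → Set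
Independent n k S =
  (∀ a b → S a b ≡ true → incomp n k a b ≡ true) ×
  (∀ a b x y → S a b ≡ true → S x y ≡ true → adj n k a b x y ≡ false)

b2n : Bool → ℕ
b2n true = 1
b2n false = 0

card : ∀ {N} → PairSet N → ℕ
card {N} S = sum (map (λ x → sum (map (λ y → b2n (S x y)) (allFin N))) (allFin N))

eqF : ∀ {N} → Fin N → Fin N → Bool
eqF x y = ⌊ x ≟ y ⌋

FEBP : (n k : ℕ) → Fin (n + k) → PairSet (n + k) → PairSet (n + k)
FEBP n k i S a b =
  S a b ∧ eqF a i ∧
  any (λ x → any (λ y → S x y ∧ eqF y (cyc i k) ∧ lt n k x b) (allFin (n + k))) (allFin (n + k))

LEBP : (n k : ℕ) → Fin (n + k) → PairSet (n + k) → PairSet (n + k)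
LEBP n k i S x y =
  S x y ∧ eqF y (cyc i k) ∧
  any (λ a → any (λ b → S a b ∧ eqF a i ∧ lt n k x b) (allFin (n + k))) (allFin (n + k))

DFEL : (n k : ℕ) → Fin (n + k) → PairSet (n + k) → PairSet (n + k)
DFEL n k i S x y =
  (S x y ∧ not (FEBP n k i S x y)) ∨
  (eqF y (cyc i (suc k)) ∧ LEBP n k i S x (cyc i k))

-- DLEF(i,S) = (S − LEBP(i,S)) ∪ {(a_{i-1}, b) : (a_i, b) ∈ FEBP(i,S)}
-- (a_{i-1} = a_{i + (N-1)} cyclically)
DLEF : (n k : ℕ) → Fin (n + k) → PairSet (n + k) → PairSet (n + k)
DLEF n k i S a b =
  (S a b ∧ not (LEBP n k i S a b)) ∨
  (eqF a (cyc i (n + k ∸ 1)) ∧ FEBP n k i S i b)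

module Submission where

-- Two facts about the crown drive the argument. If a_x ∥ b_{i+k} and x ≠ i then
-- a_x ∥ b_{i+k+1}, while a_i < b_{i+k+1}; dually, if a_i ∥ b and b ≠ b_{i+k} then
-- a_{i-1} ∥ b, while a_{i-1} < b_{i+k}. Hence the pairs added to DFEL(i,S) are
-- incomparable and not in S, and an old pair (c,d) adjacent to an added pair
-- (x,b_{i+k+1}) has c ∥ b_{i+k} and c < b_{i+k+1}, so c = a_i and (c,d) together
-- with (x,b_{i+k}) is an expansion blocking pair: (c,d) was removed. DLEF(i,S) is
-- dual. For the count, DFEL(i,S) trades FEBP(i,S) for a copy of LEBP(i,S) moved one
-- column and DLEF(i,S) trades LEBP(i,S) for a copy of FEBP(i,S) moved one row.

open import Defs
open import Data.Nat.Properties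
  using (+-0-commutativeMonoid; +-commutativeSemigroup;
         +-comm; +-assoc; +-identityʳ; +-cancelʳ-≡; m+[n∸m]≡n; m≤n+m; n<1+n; 1+n≰n;
         <⇒≤; <-trans; ≤-<-trans; ≤∧≢⇒<; _≤?_; ≤ᵇ⇒≤; ≤⇒≤ᵇ)
open import Algebra.Properties.CommutativeMonoid.Sum +-0-commutativeMonoid
  using (sum; sum-syntax; sum-cong-≗; sum-remove; sum-replicate-zero; ∑-distrib-+)
open import Algebra.Properties.CommutativeSemigroup +-commutativeSemigroup
  using (interchange; x∙yz≈y∙xz)
open import Data.Bool using (Bool; true; false; _∧_; _∨_; not)
open import Data.Bool.ListAction using (any)
open import Data.Bool.Properties using (T-≡; ¬-not)
open import Data.Empty using (⊥; ⊥-elim)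
open import Data.Fin using (Fin; toℕ; zero; suc; punchIn)
open import Data.Fin.Properties using (toℕ<n; toℕ-fromℕ<; toℕ-injective; punchInᵢ≢i; _≟_)
open import Data.List using (allFin; map; tabulate)
open import Data.List.Membership.Propositional using (lose)
open import Data.List.Membership.Propositional.Properties using (∈-allFin)
open import Data.List.Properties using (map-tabulate)
open import Data.List.Relation.Unary.Any using (satisfied)
open import Data.List.Relation.Unary.Any.Properties using (any⁺; any⁻)
open import Data.Nat using (ℕ; zero; suc; _+_; _*_; _∸_; _%_; _≤_; _<_; s≤s; NonZero)
open import Data.Nat.DivMod using (%-distribˡ-+; m%n%n≡m%n; [m+n]%n≡m%n; m<n⇒m%n≡m)
import Data.Nat.ListAction as List
open import Data.Product using (_×_; _,_; proj₁; proj₂; ∃; ∃₂)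
open import Data.Sum using (_⊎_; inj₁; inj₂)
open import Function using (_∘_; id; case_of_; Equivalence)
open import Relation.Binary.PropositionalEquality
open import Relation.Nullary using (¬_; Dec)
open import Relation.Nullary.Decidable using (toWitness; fromWitness; decidable-stable; map′)

-- Cyclic shifts and distances

[m%d+n]%d≡[m+n]%d : ∀ m n d .{{_ : NonZero d}} → (m % d + n) % d ≡ (m + n) % d
[m%d+n]%d≡[m+n]%d m n d = begin
  (m % d + n) % d          ≡⟨ %-distribˡ-+ (m % d) n d ⟩
  (m % d % d + n % d) % d  ≡⟨ cong (λ r → (r + n % d) % d) (m%n%n≡m%n m d) ⟩
  (m % d + n % d) % d      ≡⟨ %-distribˡ-+ m n d ⟨
  (m + n) % d              ∎
  where open ≡-Reasoning

[m+n%d]%d≡[m+n]%d : ∀ m n d .{{_ : NonZero d}} → (m + n % d) % d ≡ (m + n) % d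
[m+n%d]%d≡[m+n]%d m n d = begin
  (m + n % d) % d  ≡⟨ cong (_% d) (+-comm m (n % d)) ⟩
  (n % d + m) % d  ≡⟨ [m%d+n]%d≡[m+n]%d n m d ⟩
  (n + m) % d      ≡⟨ cong (_% d) (+-comm n m) ⟩
  (m + n) % d      ∎
  where open ≡-Reasoning

m+[o+[n∸m]]≡o+n : ∀ {m n} o → m ≤ n → m + (o + (n ∸ m)) ≡ o + n
m+[o+[n∸m]]≡o+n {m} {n} o m≤n = trans (x∙yz≈y∙xz m o (n ∸ m)) (cong (o +_) (m+[n∸m]≡n m≤n))

module _ {m : ℕ} where
  open ≡-Reasoning

  private
    N : ℕ
    N = suc m

    toℕ-cyc : ∀ (i : Fin N) t → toℕ (cyc i t) ≡ (toℕ i + t) % N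
    toℕ-cyc i t = toℕ-fromℕ< _

    toℕ%N : ∀ (i : Fin N) → toℕ i % N ≡ toℕ i
    toℕ%N i = m<n⇒m%n≡m (toℕ<n i)

  cyc-+ : ∀ (i : Fin N) s t → cyc (cyc i s) t ≡ cyc i (s + t)
  cyc-+ i s t = toℕ-injective (begin
    toℕ (cyc (cyc i s) t)      ≡⟨ toℕ-cyc (cyc i s) t ⟩
    (toℕ (cyc i s) + t) % N    ≡⟨ cong (λ r → (r + t) % N) (toℕ-cyc i s) ⟩
    ((toℕ i + s) % N + t) % N  ≡⟨ [m%d+n]%d≡[m+n]%d (toℕ i + s) t N ⟩
    (toℕ i + s + t) % N        ≡⟨ cong (_% N) (+-assoc (toℕ i) s t) ⟩
    (toℕ i + (s + t)) % N      ≡⟨ toℕ-cyc i (s + t) ⟨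
    toℕ (cyc i (s + t))        ∎)

  cyc-N : ∀ (i : Fin N) → cyc i N ≡ i
  cyc-N i = toℕ-injective (trans (toℕ-cyc i N) (trans ([m+n]%n≡m%n (toℕ i) N) (toℕ%N i)))

  cyc-cdist : ∀ (i j : Fin N) → cyc i (cdist i j) ≡ j
  cyc-cdist i j = toℕ-injective (begin
    toℕ (cyc i (cdist i j))                  ≡⟨ toℕ-cyc i (cdist i j) ⟩
    (toℕ i + (toℕ j + (N ∸ toℕ i)) % N) % N  ≡⟨ [m+n%d]%d≡[m+n]%d (toℕ i) _ N ⟩
    (toℕ i + (toℕ j + (N ∸ toℕ i))) % N      ≡⟨ cong (_% N) (m+[o+[n∸m]]≡o+n (toℕ j) (<⇒≤ (toℕ<n i))) ⟩
    (toℕ j + N) % N                          ≡⟨ [m+n]%n≡m%n (toℕ j) N ⟩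
    toℕ j % N                                ≡⟨ toℕ%N j ⟩
    toℕ j                                    ∎)

  cdist-cyc : ∀ (i : Fin N) {t} → t < N → cdist i (cyc i t) ≡ t
  cdist-cyc i {t} t<N = begin
    (toℕ (cyc i t) + (N ∸ toℕ i)) % N      ≡⟨ cong (λ r → (r + (N ∸ toℕ i)) % N) (toℕ-cyc i t) ⟩
    ((toℕ i + t) % N + (N ∸ toℕ i)) % N    ≡⟨ [m%d+n]%d≡[m+n]%d (toℕ i + t) _ N ⟩
    (toℕ i + t + (N ∸ toℕ i)) % N          ≡⟨ cong (_% N) (+-assoc (toℕ i) t _) ⟩
    (toℕ i + (t + (N ∸ toℕ i))) % N        ≡⟨ cong (_% N) (m+[o+[n∸m]]≡o+n t (<⇒≤ (toℕ<n i))) ⟩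
    (t + N) % N                            ≡⟨ [m+n]%n≡m%n t N ⟩
    t % N                                  ≡⟨ m<n⇒m%n≡m t<N ⟩
    t                                      ∎

  cdist-unique : ∀ (i : Fin N) {j t} → t < N → cyc i t ≡ j → cdist i j ≡ t
  cdist-unique i t<N refl = cdist-cyc i t<N

  cyc-injectiveˡ : ∀ {i j : Fin N} {t} → t ≤ N → cyc i t ≡ cyc j t → i ≡ j
  cyc-injectiveˡ {i} {j} {t} t≤N eq = begin
    i                        ≡⟨ cyc-inverse i ⟨
    cyc (cyc i t) (N ∸ t)    ≡⟨ cong (λ x → cyc x (N ∸ t)) eq ⟩
    cyc (cyc j t) (N ∸ t)    ≡⟨ cyc-inverse j ⟩
    j                        ∎
    where
    cyc-inverse : ∀ x → cyc (cyc x t) (N ∸ t) ≡ x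
    cyc-inverse x = trans (cyc-+ x t (N ∸ t)) (trans (cong (cyc x) (m+[n∸m]≡n t≤N)) (cyc-N x))

  cyc-suc : ∀ (i : Fin N) t → cyc (cyc i t) 1 ≡ cyc i (suc t)
  cyc-suc i t = trans (cyc-+ i t 1) (cong (cyc i) (+-comm t 1))

  cdist-cyc-suc : ∀ (i j : Fin N) t → suc (cdist i (cyc j t)) < N →
                  cdist i (cyc j (suc t)) ≡ suc (cdist i (cyc j t))
  cdist-cyc-suc i j t <N = cdist-unique i <N (begin
    cyc i (suc (cdist i (cyc j t)))    ≡⟨ cyc-suc i _ ⟨
    cyc (cyc i (cdist i (cyc j t))) 1  ≡⟨ cong (λ x → cyc x 1) (cyc-cdist i (cyc j t)) ⟩
    cyc (cyc j t) 1                    ≡⟨ cyc-suc j t ⟩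
    cyc j (suc t)                      ∎)

  cdist-cyc-pred : ∀ (i j : Fin N) → suc (cdist i j) < N → cdist (cyc i m) j ≡ suc (cdist i j)
  cdist-cyc-pred i j <N = cdist-unique (cyc i m) <N (begin
    cyc (cyc i m) (1 + cdist i j)      ≡⟨ cyc-+ (cyc i m) 1 _ ⟨
    cyc (cyc (cyc i m) 1) (cdist i j)  ≡⟨ cong (λ x → cyc x (cdist i j)) pred-suc ⟩
    cyc i (cdist i j)                  ≡⟨ cyc-cdist i j ⟩
    j                                  ∎)
    where
    pred-suc : cyc (cyc i m) 1 ≡ i
    pred-suc = trans (cyc-+ i m 1) (trans (cong (cyc i) (+-comm m 1)) (cyc-N i))

∧-true⁻ : ∀ x {y} → x ∧ y ≡ true → x ≡ true × y ≡ true
∧-true⁻ true y≡true = refl , y≡true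

∧-true⁺ : ∀ {x y} → x ≡ true → y ≡ true → x ∧ y ≡ true
∧-true⁺ refl y≡true = y≡true

∧-false : ∀ x {y} → (x ≡ true → y ≡ true → ⊥) → x ∧ y ≡ false
∧-false false _ = refl
∧-false true {false} _ = refl
∧-false true {true} contra = ⊥-elim (contra refl refl)

∨-true⁻ : ∀ x {y} → x ∨ y ≡ true → x ≡ true ⊎ y ≡ true
∨-true⁻ true _ = inj₁ refl
∨-true⁻ false y≡true = inj₂ y≡true

not-true⁻ : ∀ x → not x ≡ true → x ≡ false
not-true⁻ false _ = refl

eqF-true⁻ : ∀ {N} {x y : Fin N} → eqF x y ≡ true → x ≡ y
eqF-true⁻ = toWitness ∘ Equivalence.from T-≡

eqF-refl : ∀ {N} (x : Fin N) → eqF x x ≡ true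
eqF-refl x = Equivalence.to T-≡ (fromWitness refl)

any-true⁻ : ∀ {N} (p : Fin N → Bool) → any p (allFin N) ≡ true → ∃ λ x → p x ≡ true
any-true⁻ p e with x , px ← satisfied (any⁻ p (allFin _) (Equivalence.from T-≡ e)) = x , Equivalence.to T-≡ px

any-true⁺ : ∀ {N} (p : Fin N → Bool) x → p x ≡ true → any p (allFin N) ≡ true
any-true⁺ p x px = Equivalence.to T-≡ (any⁺ p (lose (∈-allFin x) (Equivalence.from T-≡ px)))

any₂-true⁻ : ∀ {N} (p : Fin N → Fin N → Bool) →
             any (λ x → any (p x) (allFin N)) (allFin N) ≡ true → ∃₂ λ x y → p x y ≡ true
any₂-true⁻ p e
  with x , e′ ← any-true⁻ _ e
  with y , pxy ← any-true⁻ (p x) e′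
  = x , y , pxy

any₂-true⁺ : ∀ {N} (p : Fin N → Fin N → Bool) x y → p x y ≡ true →
             any (λ x → any (p x) (allFin N)) (allFin N) ≡ true
any₂-true⁺ p x y pxy = any-true⁺ _ x (any-true⁺ (p x) y pxy)

-- Counting pairs

b2n-false : ∀ {b} → ¬ b ≡ true → b2n b ≡ 0
b2n-false {false} _ = refl
b2n-false {true} b≢true = ⊥-elim (b≢true refl)

b2n-replace : ∀ s f c → (f ≡ true → s ≡ true) → (c ≡ true → s ≡ false) →
              b2n ((s ∧ not f) ∨ c) + b2n f ≡ b2n s + b2n c
b2n-replace true  true  false _ _ = refl
b2n-replace true  false false _ _ = refl
b2n-replace false false true  _ _ = refl
b2n-replace false false false _ _ = refl
b2n-replace true  _     true  _ c⇒¬s = case c⇒¬s refl of λ ()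
b2n-replace false true  _ f⇒s _ = case f⇒s refl of λ ()

sum-allFin : ∀ {N} (f : Fin N → ℕ) → List.sum (map f (allFin N)) ≡ sum f
sum-allFin f = trans (cong List.sum (map-tabulate id f)) (sum-tabulate f)
  where
  sum-tabulate : ∀ {N} (g : Fin N → ℕ) → List.sum (tabulate g) ≡ sum g
  sum-tabulate {zero}  g = refl
  sum-tabulate {suc N} g = cong (g zero +_) (sum-tabulate (g ∘ suc))

sum-zero : ∀ {N} (f : Fin N → ℕ) → (∀ x → f x ≡ 0) → sum f ≡ 0
sum-zero {N} f f≡0 = trans (sum-cong-≗ f≡0) (sum-replicate-zero N)

sum-select : ∀ {N} (f : Fin N → ℕ) j → (∀ x → x ≢ j → f x ≡ 0) → sum f ≡ f j
sum-select {suc N} f j f≡0 = begin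
  sum f                          ≡⟨ sum-remove {i = j} f ⟩
  f j + sum (f ∘ punchIn j)      ≡⟨ cong (f j +_) (sum-zero _ (λ x → f≡0 _ (punchInᵢ≢i j x))) ⟩
  f j + 0                        ≡⟨ +-identityʳ (f j) ⟩
  f j                            ∎
  where open ≡-Reasoning

card≡∑∑ : ∀ {N} (A : PairSet N) → card A ≡ ∑[ x < N ] ∑[ y < N ] b2n (A x y)
card≡∑∑ {N} A = trans (sum-allFin (λ x → List.sum (map (λ y → b2n (A x y)) (allFin N))))
                       (sum-cong-≗ (λ x → sum-allFin (λ y → b2n (A x y))))

card-+ : ∀ {N} (A B C D : PairSet N) →
         (∀ x y → b2n (A x y) + b2n (B x y) ≡ b2n (C x y) + b2n (D x y)) →
         card A + card B ≡ card C + card D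
card-+ {N} A B C D pointwise = begin
  card A + card B              ≡⟨ cong₂ _+_ (card≡∑∑ A) (card≡∑∑ B) ⟩
  ∑∑ A + ∑∑ B                  ≡⟨ ∑∑-+ A B ⟨
  ∑[ x < N ] ∑[ y < N ] (b2n (A x y) + b2n (B x y))  ≡⟨ sum-cong-≗ (λ x → sum-cong-≗ (pointwise x)) ⟩
  ∑[ x < N ] ∑[ y < N ] (b2n (C x y) + b2n (D x y))  ≡⟨ ∑∑-+ C D ⟩
  ∑∑ C + ∑∑ D                  ≡⟨ cong₂ _+_ (card≡∑∑ C) (card≡∑∑ D) ⟨
  card C + card D              ∎
  where
  open ≡-Reasoning
  ∑∑ : PairSet N → ℕ
  ∑∑ E = ∑[ x < N ] ∑[ y < N ] b2n (E x y)
  ∑∑-+ : ∀ E F → ∑[ x < N ] ∑[ y < N ] (b2n (E x y) + b2n (F x y)) ≡ ∑∑ E + ∑∑ F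
  ∑∑-+ E F = trans (sum-cong-≗ (λ x → ∑-distrib-+ (λ y → b2n (E x y)) (λ y → b2n (F x y))))
                   (∑-distrib-+ (λ x → ∑[ y < N ] b2n (E x y)) (λ x → ∑[ y < N ] b2n (F x y)))

card-replace : ∀ {N} (A F C : PairSet N) →
               (∀ x y → F x y ≡ true → A x y ≡ true) → (∀ x y → C x y ≡ true → A x y ≡ false) →
               card (λ x y → (A x y ∧ not (F x y)) ∨ C x y) + card F ≡ card A + card C
card-replace A F C F⊆A C∩A≡∅ =
  card-+ _ F A C (λ x y → b2n-replace (A x y) (F x y) (C x y) (F⊆A x y) (C∩A≡∅ x y))

card-column : ∀ {N} (A : PairSet N) c → (∀ x y → A x y ≡ true → y ≡ c) →
              card A ≡ ∑[ x < N ] b2n (A x c)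
card-column A c in-column = trans (card≡∑∑ A) (sum-cong-≗ λ x →
  sum-select _ c (λ y y≢c → b2n-false (λ Axy → y≢c (in-column x y Axy))))

card-row : ∀ {N} (A : PairSet N) r → (∀ x y → A x y ≡ true → x ≡ r) →
           card A ≡ ∑[ y < N ] b2n (A r y)
card-row A r in-row = trans (card≡∑∑ A) (sum-select _ r (λ x x≢r →
  sum-zero _ (λ y → b2n-false (λ Axy → x≢r (in-row x y Axy)))))

+-exchange : ∀ d₁ d₂ f l s → d₁ + f ≡ s + l → d₂ + l ≡ s + f → d₁ + d₂ ≡ 2 * s
+-exchange d₁ d₂ f l s d₁+f≡s+l d₂+l≡s+f = +-cancelʳ-≡ (f + l) (d₁ + d₂) (2 * s) (begin
  (d₁ + d₂) + (f + l)  ≡⟨ interchange d₁ d₂ f l ⟩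
  (d₁ + f) + (d₂ + l)  ≡⟨ cong₂ _+_ d₁+f≡s+l d₂+l≡s+f ⟩
  (s + l) + (s + f)    ≡⟨ interchange s l s f ⟩
  (s + s) + (l + f)    ≡⟨ cong₂ _+_ (cong (s +_) (sym (+-identityʳ s))) (+-comm l f) ⟩
  2 * s + (f + l)      ∎)
  where open ≡-Reasoning

module Crown (n' k : ℕ) where
  private
    n N : ℕ
    n = 2 + n'
    N = n + k

    k+1<N : suc k < N
    k+1<N = s≤s (s≤s (m≤n+m k n'))

    k<N : k < N
    k<N = <-trans (n<1+n k) k+1<N

  -- x ∥ y : a_x and b_y are incomparable; otherwise a_x < b_y.
  record _∥_ (x y : Fin N) : Set where
    constructor mk∥
    field cdist≤k : cdist x y ≤ k

  _∦_ : Fin N → Fin N → Set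
  x ∦ y = ¬ x ∥ y

  _∥?_ : ∀ x y → Dec (x ∥ y)
  x ∥? y = map′ mk∥ _∥_.cdist≤k (cdist x y ≤? k)

  ∥⇒incomp : ∀ {x y} → x ∥ y → incomp n k x y ≡ true
  ∥⇒incomp (mk∥ d≤k) = Equivalence.to T-≡ (≤⇒≤ᵇ d≤k)

  incomp⇒∥ : ∀ {x y} → incomp n k x y ≡ true → x ∥ y
  incomp⇒∥ e = mk∥ (≤ᵇ⇒≤ _ _ (Equivalence.from T-≡ e))

  lt⇒∦ : ∀ {x y} → lt n k x y ≡ true → x ∦ y
  lt⇒∦ x<y x∥y = case trans (sym x<y) (cong not (∥⇒incomp x∥y)) of λ ()

  ∦⇒lt : ∀ {x y} → x ∦ y → lt n k x y ≡ true
  ∦⇒lt {x} {y} x∦y with incomp n k x y in eq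
  ... | false = refl
  ... | true  = ⊥-elim (x∦y (incomp⇒∥ eq))

  ∥-sucᵇ : ∀ {x i} → x ∥ cyc i k → x ≢ i → x ∥ cyc i (suc k)
  ∥-sucᵇ {x} {i} (mk∥ r≤k) x≢i =
    mk∥ (subst (_≤ k) (sym (cdist-cyc-suc x i k (≤-<-trans r<k k<N))) r<k)
    where
    r<k : cdist x (cyc i k) < k
    r<k = ≤∧≢⇒< r≤k λ r≡k → x≢i (cyc-injectiveˡ (<⇒≤ k<N)
      (trans (cong (cyc x) (sym r≡k)) (cyc-cdist x (cyc i k))))

  ∥-predᵃ : ∀ {i y} → i ∥ y → y ≢ cyc i k → cyc i (n + k ∸ 1) ∥ y
  ∥-predᵃ {i} {y} (mk∥ r≤k) y≢i+k =
    mk∥ (subst (_≤ k) (sym (cdist-cyc-pred i y (≤-<-trans r<k k<N))) r<k)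
    where
    r<k : cdist i y < k
    r<k = ≤∧≢⇒< r≤k λ r≡k → y≢i+k (trans (sym (cyc-cdist i y)) (cong (cyc i) r≡k))

  ∦-sucᵇ : ∀ i → i ∦ cyc i (suc k)
  ∦-sucᵇ i (mk∥ d≤k) = 1+n≰n (subst (_≤ k) (cdist-cyc i k+1<N) d≤k)

  ∦-predᵃ : ∀ i → cyc i (n + k ∸ 1) ∦ cyc i k
  ∦-predᵃ i (mk∥ d≤k) =
    1+n≰n (subst (_≤ k) (trans (cdist-cyc-pred i (cyc i k) <N) (cong suc (cdist-cyc i k<N))) d≤k)
    where
    <N : suc (cdist i (cyc i k)) < N
    <N = subst (λ r → suc r < N) (sym (cdist-cyc i k<N)) k+1<N

  independent : (A : PairSet N) → (∀ {a b} → A a b ≡ true → a ∥ b) →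
                (∀ {a b x y} → A a b ≡ true → A x y ≡ true → a ∦ y → x ∦ b → ⊥) →
                Independent n k A
  independent A members-∥ nonadjacent =
    (λ a b ab∈A → ∥⇒incomp (members-∥ ab∈A)) ,
    (λ a b x y ab∈A xy∈A → ∧-false (lt n k a y) λ a<y x<b →
      nonadjacent ab∈A xy∈A (lt⇒∦ a<y) (lt⇒∦ x<b))

  module Expansion (S : PairSet N) (S-independent : Independent n k S) (i : Fin N) where
    open ≡-Reasoning

    i+k i+k+1 i-1 : Fin N
    i+k   = cyc i k
    i+k+1 = cyc i (suc k)
    i-1   = cyc i (n + k ∸ 1)

    ∈S⇒∥ : ∀ {a b} → S a b ≡ true → a ∥ b
    ∈S⇒∥ {a} {b} ab∈S = incomp⇒∥ (proj₁ S-independent a b ab∈S)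

    ∈S-nonadjacent : ∀ {a b x y} → S a b ≡ true → S x y ≡ true → a ∦ y → x ∦ b → ⊥
    ∈S-nonadjacent {a} {b} {x} {y} ab∈S xy∈S a∦y x∦b =
      case trans (sym (proj₂ S-independent a b x y ab∈S xy∈S)) (∧-true⁺ (∦⇒lt a∦y) (∦⇒lt x∦b)) of λ ()

    ∈S-∥-across : ∀ {a b x y} → S a b ≡ true → S x y ≡ true → x ∦ b → a ∥ y
    ∈S-∥-across {a} {y = y} ab∈S xy∈S x∦b =
      decidable-stable (a ∥? y) λ a∦y → ∈S-nonadjacent ab∈S xy∈S a∦y x∦b

    record BlockingPair (a b x y : Fin N) : Set where
      constructor blocking
      field
        first∈S  : S a b ≡ true
        second∈S : S x y ≡ true
        a≡i      : a ≡ i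
        y≡i+k    : y ≡ i+k
        x∦b      : x ∦ b

    FEBP⇒blocking : ∀ {a b} → FEBP n k i S a b ≡ true → ∃₂ λ x y → BlockingPair a b x y
    FEBP⇒blocking {a} {b} e
      with ab∈S , e₁ ← ∧-true⁻ (S a b) e
      with a≡i , e₂ ← ∧-true⁻ (eqF a i) e₁
      with x , y , e₃ ← any₂-true⁻ (λ x y → S x y ∧ eqF y i+k ∧ lt n k x b) e₂
      with xy∈S , e₄ ← ∧-true⁻ (S x y) e₃
      with y≡i+k , x<b ← ∧-true⁻ (eqF y i+k) e₄
      = x , y , blocking ab∈S xy∈S (eqF-true⁻ a≡i) (eqF-true⁻ y≡i+k) (lt⇒∦ x<b)

    LEBP⇒blocking : ∀ {x y} → LEBP n k i S x y ≡ true → ∃₂ λ a b → BlockingPair a b x y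
    LEBP⇒blocking {x} {y} e
      with xy∈S , e₁ ← ∧-true⁻ (S x y) e
      with y≡i+k , e₂ ← ∧-true⁻ (eqF y i+k) e₁
      with a , b , e₃ ← any₂-true⁻ (λ a b → S a b ∧ eqF a i ∧ lt n k x b) e₂
      with ab∈S , e₄ ← ∧-true⁻ (S a b) e₃
      with a≡i , x<b ← ∧-true⁻ (eqF a i) e₄
      = a , b , blocking ab∈S xy∈S (eqF-true⁻ a≡i) (eqF-true⁻ y≡i+k) (lt⇒∦ x<b)

    blocking⇒FEBP : ∀ {a b x y} → BlockingPair a b x y → FEBP n k i S a b ≡ true
    blocking⇒FEBP {b = b} {x = x} (blocking ab∈S xy∈S refl refl x∦b) =
      ∧-true⁺ ab∈S (∧-true⁺ (eqF-refl i)
        (any₂-true⁺ (λ x y → S x y ∧ eqF y i+k ∧ lt n k x b) x i+k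
          (∧-true⁺ xy∈S (∧-true⁺ (eqF-refl i+k) (∦⇒lt x∦b)))))

    blocking⇒LEBP : ∀ {a b x y} → BlockingPair a b x y → LEBP n k i S x y ≡ true
    blocking⇒LEBP {b = b} {x = x} (blocking ab∈S xy∈S refl refl x∦b) =
      ∧-true⁺ xy∈S (∧-true⁺ (eqF-refl i+k)
        (any₂-true⁺ (λ a b → S a b ∧ eqF a i ∧ lt n k x b) i b
          (∧-true⁺ ab∈S (∧-true⁺ (eqF-refl i) (∦⇒lt x∦b)))))

    blocking-x≢i : ∀ {a b x y} → BlockingPair a b x y → x ≢ i
    blocking-x≢i (blocking ab∈S _ refl _ x∦b) refl = x∦b (∈S⇒∥ ab∈S)

    blocking-b≢i+k : ∀ {a b x y} → BlockingPair a b x y → b ≢ i+k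
    blocking-b≢i+k (blocking _ xy∈S _ refl x∦b) refl = x∦b (∈S⇒∥ xy∈S)

    blocking⇒∥-sucᵇ : ∀ {a b x y} → BlockingPair a b x y → x ∥ i+k+1
    blocking⇒∥-sucᵇ p@(blocking _ xy∈S _ refl _) = ∥-sucᵇ (∈S⇒∥ xy∈S) (blocking-x≢i p)

    blocking⇒∥-predᵃ : ∀ {a b x y} → BlockingPair a b x y → i-1 ∥ b
    blocking⇒∥-predᵃ p@(blocking ab∈S _ refl _ _) = ∥-predᵃ (∈S⇒∥ ab∈S) (blocking-b≢i+k p)

    blocking⇒sucᵇ∉S : ∀ {a b x y} → BlockingPair a b x y → S x i+k+1 ≡ false
    blocking⇒sucᵇ∉S (blocking ib∈S _ refl _ x∦b) =
      ¬-not λ x,i+k+1∈S → ∈S-nonadjacent ib∈S x,i+k+1∈S (∦-sucᵇ i) x∦b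

    blocking⇒predᵃ∉S : ∀ {a b x y} → BlockingPair a b x y → S i-1 b ≡ false
    blocking⇒predᵃ∉S (blocking _ x,i+k∈S _ refl x∦b) =
      ¬-not λ i-1,b∈S → ∈S-nonadjacent i-1,b∈S x,i+k∈S (∦-predᵃ i) x∦b

    LEBP⇒∥-sucᵇ : ∀ {x y} → LEBP n k i S x y ≡ true → x ∥ i+k+1
    LEBP⇒∥-sucᵇ e = let _ , _ , p = LEBP⇒blocking e in blocking⇒∥-sucᵇ p

    FEBP⇒∥-predᵃ : ∀ {a b} → FEBP n k i S a b ≡ true → i-1 ∥ b
    FEBP⇒∥-predᵃ e = let _ , _ , p = FEBP⇒blocking e in blocking⇒∥-predᵃ p

    LEBP⇒sucᵇ∉S : ∀ {x y} → LEBP n k i S x y ≡ true → S x i+k+1 ≡ false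
    LEBP⇒sucᵇ∉S e = let _ , _ , p = LEBP⇒blocking e in blocking⇒sucᵇ∉S p

    FEBP⇒predᵃ∉S : ∀ {a b} → FEBP n k i S a b ≡ true → S i-1 b ≡ false
    FEBP⇒predᵃ∉S e = let _ , _ , p = FEBP⇒blocking e in blocking⇒predᵃ∉S p

    FEBP⊆S : ∀ {a b} → FEBP n k i S a b ≡ true → S a b ≡ true
    FEBP⊆S {a} = proj₁ ∘ ∧-true⁻ (S a _)

    LEBP⊆S : ∀ {x y} → LEBP n k i S x y ≡ true → S x y ≡ true
    LEBP⊆S {x} = proj₁ ∘ ∧-true⁻ (S x _)

    FEBP-row : ∀ {a b} → FEBP n k i S a b ≡ true → a ≡ i
    FEBP-row e = let _ , _ , p = FEBP⇒blocking e in BlockingPair.a≡i p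

    LEBP-column : ∀ {x y} → LEBP n k i S x y ≡ true → y ≡ i+k
    LEBP-column e = let _ , _ , p = LEBP⇒blocking e in BlockingPair.y≡i+k p

    DFEL-old-new-nonadjacent : ∀ {c d e} → S c d ≡ true → FEBP n k i S c d ≡ false →
                               LEBP n k i S e i+k ≡ true → c ∦ i+k+1 → e ∦ d → ⊥
    DFEL-old-new-nonadjacent {c} {d} {e} cd∈S cd∉FEBP e∈LEBP c∦i+k+1 e∦d =
      case trans (sym cd∉FEBP) (blocking⇒FEBP (blocking cd∈S e,i+k∈S c≡i refl e∦d)) of λ ()
      where
      e,i+k∈S : S e i+k ≡ true
      e,i+k∈S = LEBP⊆S e∈LEBP
      c≡i : c ≡ i
      c≡i = decidable-stable (c ≟ i)
        λ c≢i → c∦i+k+1 (∥-sucᵇ (∈S-∥-across cd∈S e,i+k∈S e∦d) c≢i)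

    DLEF-old-new-nonadjacent : ∀ {c d b} → S c d ≡ true → LEBP n k i S c d ≡ false →
                               FEBP n k i S i b ≡ true → i-1 ∦ d → c ∦ b → ⊥
    DLEF-old-new-nonadjacent {c} {d} {b} cd∈S cd∉LEBP ib∈FEBP i-1∦d c∦b =
      case trans (sym cd∉LEBP) (blocking⇒LEBP (blocking ib∈S cd∈S refl d≡i+k c∦b)) of λ ()
      where
      ib∈S : S i b ≡ true
      ib∈S = FEBP⊆S ib∈FEBP
      d≡i+k : d ≡ i+k
      d≡i+k = decidable-stable (d ≟ i+k)
        λ d≢i+k → i-1∦d (∥-predᵃ (∈S-∥-across ib∈S cd∈S c∦b) d≢i+k)

    DFEL-cases : ∀ {a b} → DFEL n k i S a b ≡ true →
                 (S a b ≡ true × FEBP n k i S a b ≡ false) ⊎ (b ≡ i+k+1 × LEBP n k i S a i+k ≡ true)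
    DFEL-cases {a} {b} e with ∨-true⁻ (S a b ∧ not (FEBP n k i S a b)) e
    ... | inj₁ old with ab∈S , ab∉FEBP ← ∧-true⁻ (S a b) old =
      inj₁ (ab∈S , not-true⁻ _ ab∉FEBP)
    ... | inj₂ new with b≡i+k+1 , a∈LEBP ← ∧-true⁻ (eqF b i+k+1) new =
      inj₂ (eqF-true⁻ b≡i+k+1 , a∈LEBP)

    DLEF-cases : ∀ {a b} → DLEF n k i S a b ≡ true →
                 (S a b ≡ true × LEBP n k i S a b ≡ false) ⊎ (a ≡ i-1 × FEBP n k i S i b ≡ true)
    DLEF-cases {a} {b} e with ∨-true⁻ (S a b ∧ not (LEBP n k i S a b)) e
    ... | inj₁ old with ab∈S , ab∉LEBP ← ∧-true⁻ (S a b) old =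
      inj₁ (ab∈S , not-true⁻ _ ab∉LEBP)
    ... | inj₂ new with a≡i-1 , b∈FEBP ← ∧-true⁻ (eqF a i-1) new =
      inj₂ (eqF-true⁻ a≡i-1 , b∈FEBP)

    DFEL-independent : Independent n k (DFEL n k i S)
    DFEL-independent = independent (DFEL n k i S) member-∥ nonadjacent
      where
      member-∥ : ∀ {a b} → DFEL n k i S a b ≡ true → a ∥ b
      member-∥ e with DFEL-cases e
      ... | inj₁ (ab∈S , _)     = ∈S⇒∥ ab∈S
      ... | inj₂ (refl , a∈LEBP) = LEBP⇒∥-sucᵇ a∈LEBP
      nonadjacent : ∀ {a b x y} → DFEL n k i S a b ≡ true → DFEL n k i S x y ≡ true →
                    a ∦ y → x ∦ b → ⊥
      nonadjacent e₁ e₂ with DFEL-cases e₁ | DFEL-cases e₂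
      ... | inj₁ (ab∈S , _) | inj₁ (xy∈S , _) = ∈S-nonadjacent ab∈S xy∈S
      ... | inj₁ (ab∈S , ab∉FEBP) | inj₂ (refl , x∈LEBP) =
        DFEL-old-new-nonadjacent ab∈S ab∉FEBP x∈LEBP
      ... | inj₂ (refl , a∈LEBP) | inj₁ (xy∈S , xy∉FEBP) =
        λ a∦y x∦b → DFEL-old-new-nonadjacent xy∈S xy∉FEBP a∈LEBP x∦b a∦y
      ... | inj₂ (refl , a∈LEBP) | inj₂ (refl , _) = λ a∦y _ → a∦y (LEBP⇒∥-sucᵇ a∈LEBP)

    DLEF-independent : Independent n k (DLEF n k i S)
    DLEF-independent = independent (DLEF n k i S) member-∥ nonadjacent
      where
      member-∥ : ∀ {a b} → DLEF n k i S a b ≡ true → a ∥ b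
      member-∥ e with DLEF-cases e
      ... | inj₁ (ab∈S , _)     = ∈S⇒∥ ab∈S
      ... | inj₂ (refl , b∈FEBP) = FEBP⇒∥-predᵃ b∈FEBP
      nonadjacent : ∀ {a b x y} → DLEF n k i S a b ≡ true → DLEF n k i S x y ≡ true →
                    a ∦ y → x ∦ b → ⊥
      nonadjacent e₁ e₂ with DLEF-cases e₁ | DLEF-cases e₂
      ... | inj₁ (ab∈S , _) | inj₁ (xy∈S , _) = ∈S-nonadjacent ab∈S xy∈S
      ... | inj₁ (ab∈S , ab∉LEBP) | inj₂ (refl , y∈FEBP) =
        λ a∦y x∦b → DLEF-old-new-nonadjacent ab∈S ab∉LEBP y∈FEBP x∦b a∦y
      ... | inj₂ (refl , b∈FEBP) | inj₁ (xy∈S , xy∉LEBP) =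
        DLEF-old-new-nonadjacent xy∈S xy∉LEBP b∈FEBP
      ... | inj₂ (refl , _) | inj₂ (refl , y∈FEBP) = λ a∦y _ → a∦y (FEBP⇒∥-predᵃ y∈FEBP)

    DFEL-card : card (DFEL n k i S) + card (FEBP n k i S) ≡ card S + card (LEBP n k i S)
    DFEL-card = begin
      card (DFEL n k i S) + card (FEBP n k i S)
        ≡⟨ card-replace S (FEBP n k i S) new (λ _ _ → FEBP⊆S) new∩S≡∅ ⟩
      card S + card new
        ≡⟨ cong (card S +_) card-new ⟩
      card S + card (LEBP n k i S)  ∎
      where
      new : PairSet N
      new x y = eqF y i+k+1 ∧ LEBP n k i S x i+k
      new∩S≡∅ : ∀ x y → new x y ≡ true → S x y ≡ false
      new∩S≡∅ x y e with y≡i+k+1 , x∈LEBP ← ∧-true⁻ (eqF y i+k+1) e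
        rewrite eqF-true⁻ y≡i+k+1 = LEBP⇒sucᵇ∉S x∈LEBP
      card-new : card new ≡ card (LEBP n k i S)
      card-new = begin
        card new
          ≡⟨ card-column new i+k+1 (λ x y → eqF-true⁻ ∘ proj₁ ∘ ∧-true⁻ (eqF y i+k+1)) ⟩
        ∑[ x < N ] b2n (eqF i+k+1 i+k+1 ∧ LEBP n k i S x i+k)
          ≡⟨ sum-cong-≗ (λ x → cong (λ t → b2n (t ∧ LEBP n k i S x i+k)) (eqF-refl i+k+1)) ⟩
        ∑[ x < N ] b2n (LEBP n k i S x i+k)
          ≡⟨ card-column (LEBP n k i S) i+k (λ _ _ → LEBP-column) ⟨
        card (LEBP n k i S)  ∎

    DLEF-card : card (DLEF n k i S) + card (LEBP n k i S) ≡ card S + card (FEBP n k i S)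
    DLEF-card = begin
      card (DLEF n k i S) + card (LEBP n k i S)
        ≡⟨ card-replace S (LEBP n k i S) new (λ _ _ → LEBP⊆S) new∩S≡∅ ⟩
      card S + card new
        ≡⟨ cong (card S +_) card-new ⟩
      card S + card (FEBP n k i S)  ∎
      where
      new : PairSet N
      new a b = eqF a i-1 ∧ FEBP n k i S i b
      new∩S≡∅ : ∀ a b → new a b ≡ true → S a b ≡ false
      new∩S≡∅ a b e with a≡i-1 , b∈FEBP ← ∧-true⁻ (eqF a i-1) e
        rewrite eqF-true⁻ a≡i-1 = FEBP⇒predᵃ∉S b∈FEBP
      card-new : card new ≡ card (FEBP n k i S)
      card-new = begin
        card new
          ≡⟨ card-row new i-1 (λ a b → eqF-true⁻ ∘ proj₁ ∘ ∧-true⁻ (eqF a i-1)) ⟩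
        ∑[ b < N ] b2n (eqF i-1 i-1 ∧ FEBP n k i S i b)
          ≡⟨ sum-cong-≗ (λ b → cong (λ t → b2n (t ∧ FEBP n k i S i b)) (eqF-refl i-1)) ⟩
        ∑[ b < N ] b2n (FEBP n k i S i b)
          ≡⟨ card-row (FEBP n k i S) i (λ _ _ → FEBP-row) ⟨
        card (FEBP n k i S)  ∎

    DFEL+DLEF-card : card (DFEL n k i S) + card (DLEF n k i S) ≡ 2 * card S
    DFEL+DLEF-card = +-exchange (card (DFEL n k i S)) (card (DLEF n k i S))
      (card (FEBP n k i S)) (card (LEBP n k i S)) (card S) DFEL-card DLEF-card

lemma4p8 : (n k : ℕ) → 3 ≤ n → (S : PairSet (n + k)) → Independent n k S →
           (i : Fin (n + k)) →
           Independent n k (DFEL n k i S) × Independent n k (DLEF n k i S) ×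
           (card (DFEL n k i S) + card (DLEF n k i S) ≡ 2 * card S)
lemma4p8 (suc (suc (suc n'))) k (s≤s (s≤s (s≤s _))) S S-independent i =
  DFEL-independent , DLEF-independent , DFEL+DLEF-card
  where open Crown.Expansion (suc n') k S S-independent i
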